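{- Given multi-sets $\Gamma,\Delta$ of formulas in $\mathcal{L}^1$, $\mathsf{G}(\mathbf{KT_n})\vdash \Gamma\Rightarrow \Delta$ if and only if $\mathsf{G}(\mathbf{KT_n^+})\vdash \emptyset|\Gamma\Rightarrow \Delta$.
   Context: The language $\mathcal{L}^1$ has formulas $A ::= p \mid \bot \mid A\wedge A \mid A\lor A \mid A\rightarrow A \mid \neg A \mid \Box_i A$, with $p$ a propositional variable and $i$ ranging over a finite set of agents. A sequent $\Gamma\Rightarrow\Delta$ is a pair of finite multisets of formulas. The sequent calculus $\mathsf{G}(\mathbf{KT_n})$ has initial sequents $\Gamma,p\Rightarrow p,\Delta$ and $\bot,\Gamma\Rightarrow\Delta$; the G3cp-style logical rules for $\wedge,\lor,\rightarrow,\neg$ (contexts shared); the modal rule $(\Box_{Kn})$: from $\Gamma\Rightarrow A$ infer $\Sigma,\Box_i\Gamma\Rightarrow\Box_iA,\Omega$, where $\Sigma$ contains only propositional variables, $\bot$, or outmost-boxed formulas with a modality other than $\Box_i$, and $\Omega$ contains only propositional variables, $\bot$, or outmost-boxed formulas; and the rule $(\Box_{Tn})$: from $\Box_iA,A,\Gamma\Rightarrow\Delta$ infer $\Box_iA,\Gamma\Rightarrow\Delta$. A $\mathbf{T}$-sequent $\Sigma|\Gamma\Rightarrow\Delta$ adds to a sequent $\Gamma\Rightarrow\Delta$ a finite multiset $\Sigma$ of outmost-boxed formulas. The calculus $\mathsf{G}(\mathbf{KT_n^+})$ on $\mathbf{T}$-sequents has initial sequents $\Sigma|\Gamma,p\Rightarrow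 p,\Delta$ and $\Sigma|\bot,\Gamma\Rightarrow\Delta$; the same logical rules with $\Sigma$ carried unchanged from premises to conclusion; the rule $(\Box_{Kn}^+)$: from $\emptyset|\Gamma\Rightarrow A$ infer $\Sigma,\Box_i\Gamma\,|\,\Pi\Rightarrow\Box_iA,\Omega$, where $\Sigma$ contains only outmost-boxed formulas with a modality other than $\Box_i$, $\Pi$ contains only propositional variables and $\bot$, and $\Omega$ contains only propositional variables, $\bot$, or outmost-boxed formulas; and the rule $(\Box_{Tn}^+)$: from $\Box_iA,\Sigma\,|\,\Gamma,A\Rightarrow\Delta$ infer $\Sigma\,|\,\Gamma,\Box_iA\Rightarrow\Delta$. -}

module Defs where

open import Data.Nat using (ℕ)
open import Data.Fin using (Fin)
open import Data.List using (List; []; _∷_; _++_; map)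
open import Data.List.Relation.Unary.All using (All)
open import Data.List.Relation.Binary.Permutation.Propositional using (_↭_)
open import Data.Empty using (⊥)
open import Data.Unit using (⊤)
open import Relation.Binary.PropositionalEquality using (_≡_)
open import Relation.Nullary using (¬_)

data Fm (n : ℕ) : Set where
  var  : ℕ → Fm n
  fls  : Fm n
  _∧'_ : Fm n → Fm n → Fm n
  _∨'_ : Fm n → Fm n → Fm n
  _⇒'_ : Fm n → Fm n → Fm n
  ¬'_  : Fm n → Fm n
  □    : Fin n → Fm n → Fm n

module _ {n : ℕ} where

  IsAtom : Fm n → Set
  IsAtom (var _) = ⊤
  IsAtom fls     = ⊤
  IsAtom _       = ⊥

  IsBoxed : Fm n → Set
  IsBoxed (□ _ _) = ⊤
  IsBoxed _       = ⊥

  IsBoxedNot : Fin n → Fm n → Set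
  IsBoxedNot i (□ j _) = ¬ (i ≡ j)
  IsBoxedNot i _       = ⊥

  SigmaK : Fin n → Fm n → Set
  SigmaK i A = IsAtom A Data.Sum.⊎ IsBoxedNot i A
    where import Data.Sum

  OmegaK : Fm n → Set
  OmegaK A = IsAtom A Data.Sum.⊎ IsBoxed A
    where import Data.Sum

  -- Sequents are pairs of finite multisets, represented as lists closed
  -- under permutation (rule `perm`).  Principal formulas sit at the head.

  data G : List (Fm n) → List (Fm n) → Set where
    ax    : ∀ {Γ Δ} p → G (var p ∷ Γ) (var p ∷ Δ)
    ax⊥   : ∀ {Γ Δ} → G (fls ∷ Γ) Δ
    perm  : ∀ {Γ Γ' Δ Δ'} → Γ ↭ Γ' → Δ ↭ Δ' → G Γ Δ → G Γ' Δ'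
    ∧L    : ∀ {Γ Δ A B} → G (A ∷ B ∷ Γ) Δ → G ((A ∧' B) ∷ Γ) Δ
    ∧R    : ∀ {Γ Δ A B} → G Γ (A ∷ Δ) → G Γ (B ∷ Δ) → G Γ ((A ∧' B) ∷ Δ)
    ∨L    : ∀ {Γ Δ A B} → G (A ∷ Γ) Δ → G (B ∷ Γ) Δ → G ((A ∨' B) ∷ Γ) Δ
    ∨R    : ∀ {Γ Δ A B} → G Γ (A ∷ B ∷ Δ) → G Γ ((A ∨' B) ∷ Δ)
    →L    : ∀ {Γ Δ A B} → G Γ (A ∷ Δ) → G (B ∷ Γ) Δ → G ((A ⇒' B) ∷ Γ) Δ
    →R    : ∀ {Γ Δ A B} → G (A ∷ Γ) (B ∷ Δ) → G Γ ((A ⇒' B) ∷ Δ)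
    ¬L    : ∀ {Γ Δ A} → G Γ (A ∷ Δ) → G ((¬' A) ∷ Γ) Δ
    ¬R    : ∀ {Γ Δ A} → G (A ∷ Γ) Δ → G Γ ((¬' A) ∷ Δ)
    □Kn   : ∀ {Γ A Σ Ω} (i : Fin n) → All (SigmaK i) Σ → All OmegaK Ω →
            G Γ (A ∷ []) → G (Σ ++ map (□ i) Γ) (□ i A ∷ Ω)
    □Tn   : ∀ {Γ Δ A} (i : Fin n) → G (□ i A ∷ A ∷ Γ) Δ → G (□ i A ∷ Γ) Δ

  -- Calculus G(KT_n⁺) on T-sequents Σ | Γ ⇒ Δ (Σ : outmost-boxed formulas)
  data G⁺ : List (Fm n) → List (Fm n) → List (Fm n) → Set where
    ax    : ∀ {Σ Γ Δ} p → All IsBoxed Σ → G⁺ Σ (var p ∷ Γ) (var p ∷ Δ)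
    ax⊥   : ∀ {Σ Γ Δ} → All IsBoxed Σ → G⁺ Σ (fls ∷ Γ) Δ
    perm  : ∀ {Σ Σ' Γ Γ' Δ Δ'} → Σ ↭ Σ' → Γ ↭ Γ' → Δ ↭ Δ' → G⁺ Σ Γ Δ → G⁺ Σ' Γ' Δ'
    ∧L    : ∀ {Σ Γ Δ A B} → G⁺ Σ (A ∷ B ∷ Γ) Δ → G⁺ Σ ((A ∧' B) ∷ Γ) Δ
    ∧R    : ∀ {Σ Γ Δ A B} → G⁺ Σ Γ (A ∷ Δ) → G⁺ Σ Γ (B ∷ Δ) → G⁺ Σ Γ ((A ∧' B) ∷ Δ)
    ∨L    : ∀ {Σ Γ Δ A B} → G⁺ Σ (A ∷ Γ) Δ → G⁺ Σ (B ∷ Γ) Δ → G⁺ Σ ((A ∨' B) ∷ Γ) Δ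
    ∨R    : ∀ {Σ Γ Δ A B} → G⁺ Σ Γ (A ∷ B ∷ Δ) → G⁺ Σ Γ ((A ∨' B) ∷ Δ)
    →L    : ∀ {Σ Γ Δ A B} → G⁺ Σ Γ (A ∷ Δ) → G⁺ Σ (B ∷ Γ) Δ → G⁺ Σ ((A ⇒' B) ∷ Γ) Δ
    →R    : ∀ {Σ Γ Δ A B} → G⁺ Σ (A ∷ Γ) (B ∷ Δ) → G⁺ Σ Γ ((A ⇒' B) ∷ Δ)
    ¬L    : ∀ {Σ Γ Δ A} → G⁺ Σ Γ (A ∷ Δ) → G⁺ Σ ((¬' A) ∷ Γ) Δ
    ¬R    : ∀ {Σ Γ Δ A} → G⁺ Σ (A ∷ Γ) Δ → G⁺ Σ Γ ((¬' A) ∷ Δ)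
    □Kn⁺  : ∀ {Γ A Σ Π Ω} (i : Fin n) → All (IsBoxedNot i) Σ → All IsAtom Π →
            All OmegaK Ω →
            G⁺ [] Γ (A ∷ []) → G⁺ (Σ ++ map (□ i) Γ) Π (□ i A ∷ Ω)
    □Tn⁺  : ∀ {Σ Γ Δ A} (i : Fin n) → G⁺ (□ i A ∷ Σ) (A ∷ Γ) Δ → G⁺ Σ (□ i A ∷ Γ) Δ

{-# OPTIONS --safe #-}
-- G(KT_n⁺) is G(KT_n) in which the boxed formulas unpacked by □Tn are set aside in the store Σ, so
-- that □Kn⁺ can require an atomic antecedent. Erasing the bar turns every G(KT_n⁺)-rule into a
-- G(KT_n)-rule. Conversely, □Kn is simulated by □Kn⁺ with empty side contexts, followed by weakening
-- and by □Tn⁺, which moves the boxes □ᵢΓ from the store back into the antecedent; □Tn, which keeps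
-- its principal formula, is simulated by inverting □Tn⁺ and contracting the duplicated A. So all
-- rests on weakening, contraction and invertibility in G(KT_n⁺); contracting two copies of □ᵢA in
-- the store reduces, at □Kn⁺, to contracting two copies of A in its premise.
module Submission where

open import Defs
open import Level using (Level)
open import Data.Nat using (ℕ)
open import Data.Fin using (Fin)
open import Data.Fin.Properties using () renaming (_≟_ to _≟ᶠ_)
open import Data.List using (List; []; _∷_; _++_; map)
open import Data.List.Properties using (map-++)
open import Data.List.Relation.Unary.All as All using (All; []; _∷_)
import Data.List.Relation.Unary.All.Properties as Allₚ
open import Data.List.Relation.Unary.Any using (here; there)
open import Data.List.Membership.Propositional using (_∈_)
open import Data.List.Membership.Propositional.Properties
  using (∈-∃++; ∈-++⁺ʳ; ∈-++⁻; ∈-map⁻)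
open import Data.List.Relation.Binary.Permutation.Propositional
  using (_↭_; ↭-refl; ↭-sym; ↭-trans; ↭-prep; ↭-swap; module PermutationReasoning)
open import Data.List.Relation.Binary.Permutation.Propositional.Properties
  using ( ∈-resp-↭; All-resp-↭; drop-∷; shift; shifts; ++⁺ˡ; ++⁺ʳ; ++-identityʳ; map⁺
        ; ++-commutativeMonoid)
import Algebra.Solver.CommutativeMonoid as CommutativeMonoidSolver
open import Data.Product using (_×_; _,_; proj₂; ∃; ∃₂)
open import Data.Sum using (_⊎_; inj₁; inj₂)
open import Data.Empty using (⊥-elim)
open import Data.Unit using (tt)
open import Relation.Binary.PropositionalEquality using (_≡_; _≢_; refl; sym; cong)
open import Relation.Nullary using (¬_; yes; no)

private
  variable
    ℓ : Level
    X : Set ℓ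
    x y w : X
    xs ys zs : List X

∈-∃↭∷ : x ∈ xs → ∃ λ ys → xs ↭ x ∷ ys
∈-∃↭∷ x∈xs with ys , zs , refl ← ∈-∃++ x∈xs = ys ++ zs , shift _ ys zs

∈-∷-contract : x ∈ y ∷ y ∷ xs → x ∈ y ∷ xs
∈-∷-contract (here x≡y)     = here x≡y
∈-∷-contract (there x∈y∷xs) = x∈y∷xs

↭-prep-swap : xs ↭ x ∷ zs → y ∷ xs ↭ x ∷ y ∷ zs
↭-prep-swap {x = x} {y = y} p = ↭-trans (↭-prep y p) (↭-swap y x ↭-refl)

↭-prep-swap₂ : xs ↭ x ∷ y ∷ zs → w ∷ xs ↭ x ∷ y ∷ w ∷ zs
↭-prep-swap₂ {x = x} {y = y} {w = w} p = ↭-trans (↭-prep w p) (shifts (w ∷ []) (x ∷ y ∷ []))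

++-pull : ∀ ws → xs ↭ x ∷ zs → ws ++ xs ↭ x ∷ ws ++ zs
++-pull ws p = ↭-trans (++⁺ˡ ws p) (shift _ ws _)

↭-∷-inv : x ∷ xs ↭ y ∷ ys → (x ≡ y × xs ↭ ys) ⊎ ∃ λ zs → xs ↭ y ∷ zs × ys ↭ x ∷ zs
↭-∷-inv p with ∈-resp-↭ (↭-sym p) (here refl)
... | here refl  = inj₁ (refl , drop-∷ p)
... | there y∈xs with zs , xs↭ ← ∈-∃↭∷ y∈xs =
  inj₂ (zs , xs↭ , drop-∷ (↭-trans (↭-sym p) (↭-prep-swap xs↭)))

↭-∷∷-inv : x ≢ y → x ∷ xs ↭ y ∷ y ∷ ys → ∃ λ zs → ys ↭ x ∷ zs × xs ↭ y ∷ y ∷ zs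
↭-∷∷-inv x≢y p with ↭-∷-inv p
... | inj₁ (x≡y , _) = ⊥-elim (x≢y x≡y)
... | inj₂ (zs , xs↭ , y∷ys↭) with ↭-∷-inv y∷ys↭
...   | inj₁ (y≡x , _)        = ⊥-elim (x≢y (sym y≡x))
...   | inj₂ (ws , ys↭ , zs↭) = ws , ys↭ , ↭-trans xs↭ (↭-prep _ zs↭)

module _ {n : ℕ} where

  open CommutativeMonoidSolver (++-commutativeMonoid {A = Fm n}) using (solve; _⊜_; _⊕_; id)

  private
    variable
      i j : Fin n
      p : ℕ
      A B C F : Fm n
      Σ Σ' Σ₀ Γ Γ' Γ₀ Δ Δ' T : List (Fm n)

  permΣ : Σ ↭ Σ' → G⁺ Σ Γ Δ → G⁺ Σ' Γ Δ
  permΣ σ = perm σ ↭-refl ↭-refl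

  permΓ : Γ ↭ Γ' → G⁺ Σ Γ Δ → G⁺ Σ Γ' Δ
  permΓ γ = perm ↭-refl γ ↭-refl

  permΔ : Δ ↭ Δ' → G⁺ Σ Γ Δ → G⁺ Σ Γ Δ'
  permΔ δ = perm ↭-refl ↭-refl δ

  exchangeΣ : G⁺ (A ∷ B ∷ Σ) Γ Δ → G⁺ (B ∷ A ∷ Σ) Γ Δ
  exchangeΣ = permΣ (↭-swap _ _ ↭-refl)

  exchangeΓ : G⁺ Σ (A ∷ B ∷ Γ) Δ → G⁺ Σ (B ∷ A ∷ Γ) Δ
  exchangeΓ = permΓ (↭-swap _ _ ↭-refl)

  exchangeΔ : G⁺ Σ Γ (A ∷ B ∷ Δ) → G⁺ Σ Γ (B ∷ A ∷ Δ)
  exchangeΔ = permΔ (↭-swap _ _ ↭-refl)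

  shiftΓ : ∀ L → G⁺ Σ (L ++ A ∷ Γ) Δ → G⁺ Σ (A ∷ L ++ Γ) Δ
  shiftΓ L = permΓ (shift _ L _)

  shiftΓ₂ : ∀ L → G⁺ Σ (L ++ A ∷ B ∷ Γ) Δ → G⁺ Σ (A ∷ B ∷ L ++ Γ) Δ
  shiftΓ₂ L = permΓ (shifts L (_ ∷ _ ∷ []))

  unshiftΓ : ∀ L → G⁺ Σ (A ∷ L ++ Γ) Δ → G⁺ Σ (L ++ A ∷ Γ) Δ
  unshiftΓ L = permΓ (↭-sym (shift _ L _))

  shiftΔ : ∀ R → G⁺ Σ Γ (R ++ A ∷ Δ) → G⁺ Σ Γ (A ∷ R ++ Δ)
  shiftΔ R = permΔ (shift _ R _)

  shiftΔ₂ : ∀ R → G⁺ Σ Γ (R ++ A ∷ B ∷ Δ) → G⁺ Σ Γ (A ∷ B ∷ R ++ Δ)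
  shiftΔ₂ R = permΔ (shifts R (_ ∷ _ ∷ []))

  unshiftΔ : ∀ R → G⁺ Σ Γ (A ∷ R ++ Δ) → G⁺ Σ Γ (R ++ A ∷ Δ)
  unshiftΔ R = permΔ (↭-sym (shift _ R _))

  ax∈ : All IsBoxed Σ → var p ∈ Γ → var p ∈ Δ → G⁺ Σ Γ Δ
  ax∈ boxed p∈Γ p∈Δ =
    let _ , Γ↭ = ∈-∃↭∷ p∈Γ
        _ , Δ↭ = ∈-∃↭∷ p∈Δ
    in  perm ↭-refl (↭-sym Γ↭) (↭-sym Δ↭) (ax _ boxed)

  ax⊥∈ : All IsBoxed Σ → fls ∈ Γ → G⁺ Σ Γ Δ
  ax⊥∈ boxed ⊥∈Γ = permΓ (↭-sym (proj₂ (∈-∃↭∷ ⊥∈Γ))) (ax⊥ boxed)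

  IsBoxedNot⇒IsBoxed : IsBoxedNot i A → IsBoxed A
  IsBoxedNot⇒IsBoxed {A = □ _ _}  _  = tt
  IsBoxedNot⇒IsBoxed {A = var _}  ()
  IsBoxedNot⇒IsBoxed {A = fls}    ()
  IsBoxedNot⇒IsBoxed {A = _ ∧' _} ()
  IsBoxedNot⇒IsBoxed {A = _ ∨' _} ()
  IsBoxedNot⇒IsBoxed {A = _ ⇒' _} ()
  IsBoxedNot⇒IsBoxed {A = ¬' _}   ()

  map-□-boxed : (i : Fin n) (Γ : List (Fm n)) → All IsBoxed (map (□ i) Γ)
  map-□-boxed i Γ = Allₚ.map⁺ (All.universal (λ _ → tt) Γ)

  Σ-boxed : G⁺ Σ Γ Δ → All IsBoxed Σ
  Σ-boxed (ax _ boxed)   = boxed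
  Σ-boxed (ax⊥ boxed)    = boxed
  Σ-boxed (perm σ _ _ d) = All-resp-↭ σ (Σ-boxed d)
  Σ-boxed (∧L d)         = Σ-boxed d
  Σ-boxed (∧R d _)       = Σ-boxed d
  Σ-boxed (∨L d _)       = Σ-boxed d
  Σ-boxed (∨R d)         = Σ-boxed d
  Σ-boxed (→L d _)       = Σ-boxed d
  Σ-boxed (→R d)         = Σ-boxed d
  Σ-boxed (¬L d)         = Σ-boxed d
  Σ-boxed (¬R d)         = Σ-boxed d
  Σ-boxed (□Tn⁺ _ d)     = All.tail (Σ-boxed d)
  Σ-boxed (□Kn⁺ {Γ = Γ} i others _ _ _) =
    Allₚ.++⁺ (All.map IsBoxedNot⇒IsBoxed others) (map-□-boxed i Γ)

  -- Adding boxes to Σ, atoms to Γ and Ω-formulas to Δ commutes with every rule (at □Kn⁺ the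
  -- added boxes of the rule's agent go into the premise); any other formula is then added by
  -- decomposing it with its own rule.
  Extension : List (Fm n) → List (Fm n) → List (Fm n) → Set
  Extension Σ⁺ Π Ω = All IsBoxed Σ⁺ × All IsAtom Π × All OmegaK Ω

  Weakenable : List (Fm n) → List (Fm n) → List (Fm n) → Set
  Weakenable Σ Γ Δ = ∀ {Σ⁺ Π Ω} → Extension Σ⁺ Π Ω → G⁺ (Σ⁺ ++ Σ) (Π ++ Γ) (Ω ++ Δ)

  weakenableˡ : ∀ A → Weakenable Σ Γ Δ → Weakenable Σ (A ∷ Γ) Δ
  weakenableʳ : ∀ A → Weakenable Σ Γ Δ → Weakenable Σ Γ (A ∷ Δ)

  weakenableˡ (var p) w {Π = Π} (b , a , o) = unshiftΓ Π (w {Π = var p ∷ Π} (b , tt ∷ a , o))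
  weakenableˡ fls w {Π = Π} ext = ax⊥∈ (Σ-boxed (w ext)) (∈-++⁺ʳ Π (here refl))
  weakenableˡ (A ∧' B) w {Π = Π} ext =
    unshiftΓ Π (∧L (shiftΓ₂ Π (weakenableˡ A (weakenableˡ B w) ext)))
  weakenableˡ (A ∨' B) w {Π = Π} ext =
    unshiftΓ Π (∨L (shiftΓ Π (weakenableˡ A w ext)) (shiftΓ Π (weakenableˡ B w ext)))
  weakenableˡ (A ⇒' B) w {Π = Π} {Ω} ext =
    unshiftΓ Π (→L (shiftΔ Ω (weakenableʳ A w ext)) (shiftΓ Π (weakenableˡ B w ext)))
  weakenableˡ (¬' A) w {Π = Π} {Ω} ext =
    unshiftΓ Π (¬L (shiftΔ Ω (weakenableʳ A w ext)))
  weakenableˡ (□ i A) w {Σ⁺} {Π} (b , a , o) =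
    unshiftΓ Π (□Tn⁺ i (shiftΓ Π (weakenableˡ A w {Σ⁺ = □ i A ∷ Σ⁺} (tt ∷ b , a , o))))

  weakenableʳ (var p) w {Ω = Ω} (b , a , o) = unshiftΔ Ω (w {Ω = var p ∷ Ω} (b , a , inj₁ tt ∷ o))
  weakenableʳ fls     w {Ω = Ω} (b , a , o) = unshiftΔ Ω (w {Ω = fls ∷ Ω} (b , a , inj₁ tt ∷ o))
  weakenableʳ (□ i A) w {Ω = Ω} (b , a , o) = unshiftΔ Ω (w {Ω = □ i A ∷ Ω} (b , a , inj₂ tt ∷ o))
  weakenableʳ (A ∧' B) w {Ω = Ω} ext =
    unshiftΔ Ω (∧R (shiftΔ Ω (weakenableʳ A w ext)) (shiftΔ Ω (weakenableʳ B w ext)))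
  weakenableʳ (A ∨' B) w {Ω = Ω} ext =
    unshiftΔ Ω (∨R (shiftΔ₂ Ω (weakenableʳ A (weakenableʳ B w) ext)))
  weakenableʳ (A ⇒' B) w {Π = Π} {Ω} ext =
    unshiftΔ Ω (→R (shiftΓ Π (shiftΔ Ω (weakenableˡ A (weakenableʳ B w) ext))))
  weakenableʳ (¬' A) w {Π = Π} {Ω} ext =
    unshiftΔ Ω (¬R (shiftΓ Π (weakenableˡ A w ext)))

  weakenable⋆ˡ : ∀ Λ → Weakenable Σ Γ Δ → Weakenable Σ (Λ ++ Γ) Δ
  weakenable⋆ˡ []      w = w
  weakenable⋆ˡ (A ∷ Λ) w = weakenableˡ A (weakenable⋆ˡ Λ w)

  partition-by-agent : (i : Fin n) → All IsBoxed Σ →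
                       ∃₂ λ Σ₀ Γ₀ → All (IsBoxedNot i) Σ₀ × Σ ↭ Σ₀ ++ map (□ i) Γ₀
  partition-by-agent i [] = [] , [] , [] , ↭-refl
  partition-by-agent {Σ = □ j C ∷ _} i (_ ∷ boxed) with partition-by-agent i boxed | i ≟ᶠ j
  ... | Σ₀ , Γ₀ , others , Σ↭ | yes refl =
    Σ₀ , C ∷ Γ₀ , others , ↭-trans (↭-prep _ Σ↭) (↭-sym (shift _ Σ₀ _))
  ... | Σ₀ , Γ₀ , others , Σ↭ | no i≢j =
    □ j C ∷ Σ₀ , Γ₀ , i≢j ∷ others , ↭-prep _ Σ↭
  partition-by-agent {Σ = var _ ∷ _}  i (() ∷ _)
  partition-by-agent {Σ = fls ∷ _}    i (() ∷ _)
  partition-by-agent {Σ = _ ∧' _ ∷ _} i (() ∷ _)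
  partition-by-agent {Σ = _ ∨' _ ∷ _} i (() ∷ _)
  partition-by-agent {Σ = _ ⇒' _ ∷ _} i (() ∷ _)
  partition-by-agent {Σ = ¬' _ ∷ _}   i (() ∷ _)

  weakenable : G⁺ Σ Γ Δ → Weakenable Σ Γ Δ
  weakenable (ax p boxed) {Π = Π} {Ω} (b , _ , _) =
    ax∈ (Allₚ.++⁺ b boxed) (∈-++⁺ʳ Π (here refl)) (∈-++⁺ʳ Ω (here refl))
  weakenable (ax⊥ boxed) {Π = Π} (b , _ , _) = ax⊥∈ (Allₚ.++⁺ b boxed) (∈-++⁺ʳ Π (here refl))
  weakenable (perm σ γ δ d) {Σ⁺} {Π} {Ω} ext =
    perm (++⁺ˡ Σ⁺ σ) (++⁺ˡ Π γ) (++⁺ˡ Ω δ) (weakenable d ext)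
  weakenable (∧L d) {Π = Π} ext = unshiftΓ Π (∧L (shiftΓ₂ Π (weakenable d ext)))
  weakenable (∧R d₁ d₂) {Ω = Ω} ext =
    unshiftΔ Ω (∧R (shiftΔ Ω (weakenable d₁ ext)) (shiftΔ Ω (weakenable d₂ ext)))
  weakenable (∨L d₁ d₂) {Π = Π} ext =
    unshiftΓ Π (∨L (shiftΓ Π (weakenable d₁ ext)) (shiftΓ Π (weakenable d₂ ext)))
  weakenable (∨R d) {Ω = Ω} ext = unshiftΔ Ω (∨R (shiftΔ₂ Ω (weakenable d ext)))
  weakenable (→L d₁ d₂) {Π = Π} {Ω} ext =
    unshiftΓ Π (→L (shiftΔ Ω (weakenable d₁ ext)) (shiftΓ Π (weakenable d₂ ext)))
  weakenable (→R d) {Π = Π} {Ω} ext = unshiftΔ Ω (→R (shiftΓ Π (shiftΔ Ω (weakenable d ext))))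
  weakenable (¬L d) {Π = Π} {Ω} ext = unshiftΓ Π (¬L (shiftΔ Ω (weakenable d ext)))
  weakenable (¬R d) {Π = Π} {Ω} ext = unshiftΔ Ω (¬R (shiftΓ Π (weakenable d ext)))
  weakenable (□Tn⁺ i d) {Σ⁺} {Π} ext =
    unshiftΓ Π (□Tn⁺ i (perm (shift _ Σ⁺ _) (shift _ Π _) ↭-refl (weakenable d ext)))
  weakenable (□Kn⁺ {Γ = Γ₀} {Σ = Σ₀} i others atoms omega d) {Σ⁺} {Ω = Ω} (b , a , o)
    with Σ₁ , Γ₁ , others⁺ , Σ⁺↭ ← partition-by-agent i b =
    perm store↭ ↭-refl (↭-sym (shift _ Ω _))
         (□Kn⁺ i (Allₚ.++⁺ others⁺ others) (Allₚ.++⁺ a atoms) (Allₚ.++⁺ o omega)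
               (weakenable⋆ˡ Γ₁ (weakenable d) ([] , [] , [])))
    where
    open PermutationReasoning
    interchange : ∀ ws xs ys zs → (ws ++ xs) ++ ys ++ zs ↭ (ws ++ ys) ++ xs ++ zs
    interchange =
      solve 4 (λ ws xs ys zs → (ws ⊕ xs) ⊕ (ys ⊕ zs) ⊜ (ws ⊕ ys) ⊕ (xs ⊕ zs)) ↭-refl
    store↭ : (Σ₁ ++ Σ₀) ++ map (□ i) (Γ₁ ++ Γ₀) ↭ Σ⁺ ++ Σ₀ ++ map (□ i) Γ₀
    store↭ = begin
      (Σ₁ ++ Σ₀) ++ map (□ i) (Γ₁ ++ Γ₀)          ≡⟨ cong ((Σ₁ ++ Σ₀) ++_) (map-++ (□ i) Γ₁ Γ₀) ⟩
      (Σ₁ ++ Σ₀) ++ map (□ i) Γ₁ ++ map (□ i) Γ₀  ↭⟨ interchange Σ₁ Σ₀ _ _ ⟩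
      (Σ₁ ++ map (□ i) Γ₁) ++ Σ₀ ++ map (□ i) Γ₀  ↭⟨ ++⁺ʳ _ (↭-sym Σ⁺↭) ⟩
      Σ⁺ ++ Σ₀ ++ map (□ i) Γ₀                     ∎

  weakenˡ : ∀ Λ → G⁺ Σ Γ Δ → G⁺ Σ (Λ ++ Γ) Δ
  weakenˡ Λ d = weakenable⋆ˡ Λ (weakenable d) ([] , [] , [])

  data LeftPremises (Σ : List (Fm n)) : Fm n → List (Fm n) → List (Fm n) → Set where
    ∧L   : G⁺ Σ (A ∷ B ∷ Γ) Δ → LeftPremises Σ (A ∧' B) Γ Δ
    ∨L   : G⁺ Σ (A ∷ Γ) Δ → G⁺ Σ (B ∷ Γ) Δ → LeftPremises Σ (A ∨' B) Γ Δ
    →L   : G⁺ Σ Γ (A ∷ Δ) → G⁺ Σ (B ∷ Γ) Δ → LeftPremises Σ (A ⇒' B) Γ Δ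
    ¬L   : G⁺ Σ Γ (A ∷ Δ) → LeftPremises Σ (¬' A) Γ Δ
    □Tn⁺ : G⁺ (□ i A ∷ Σ) (A ∷ Γ) Δ → LeftPremises Σ (□ i A) Γ Δ

  data RightPremises (Σ : List (Fm n)) : Fm n → List (Fm n) → List (Fm n) → Set where
    ∧R : G⁺ Σ Γ (A ∷ Δ) → G⁺ Σ Γ (B ∷ Δ) → RightPremises Σ (A ∧' B) Γ Δ
    ∨R : G⁺ Σ Γ (A ∷ B ∷ Δ) → RightPremises Σ (A ∨' B) Γ Δ
    →R : G⁺ Σ (A ∷ Γ) (B ∷ Δ) → RightPremises Σ (A ⇒' B) Γ Δ
    ¬R : G⁺ Σ (A ∷ Γ) Δ → RightPremises Σ (¬' A) Γ Δ

  -- Every rule in which F is not principal commutes with replacing F in Γ by L and adding R to Δ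
  -- and S to Σ, so only the principal case needs an argument.
  module _ (F : Fm n) {S : List (Fm n)} (L R : List (Fm n))
           (S-boxed : All IsBoxed S) (F-compound : ¬ IsAtom F)
           (principal : ∀ {Σ Γ Δ} → LeftPremises Σ F Γ Δ → G⁺ (S ++ Σ) (L ++ Γ) (R ++ Δ))
           where

    private
      reinsert : Γ' ↭ A ∷ T → G⁺ Σ (A ∷ L ++ T) Δ → G⁺ Σ (L ++ Γ') Δ
      reinsert Γ'↭ = permΓ (↭-sym (++-pull L Γ'↭))

    invertˡ : G⁺ Σ Γ Δ → Γ ↭ F ∷ Γ' → G⁺ (S ++ Σ) (L ++ Γ') (R ++ Δ)
    invertˡ (ax p boxed) e with ∈-resp-↭ e (here refl)
    ... | here refl  = ⊥-elim (F-compound tt)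
    ... | there p∈Γ' = ax∈ (Allₚ.++⁺ S-boxed boxed) (∈-++⁺ʳ L p∈Γ') (∈-++⁺ʳ R (here refl))
    invertˡ (ax⊥ boxed) e with ∈-resp-↭ e (here refl)
    ... | here refl  = ⊥-elim (F-compound tt)
    ... | there ⊥∈Γ' = ax⊥∈ (Allₚ.++⁺ S-boxed boxed) (∈-++⁺ʳ L ⊥∈Γ')
    invertˡ (perm σ γ δ d) e = perm (++⁺ˡ S σ) ↭-refl (++⁺ˡ R δ) (invertˡ d (↭-trans γ e))
    invertˡ (∧R d₁ d₂) e = unshiftΔ R (∧R (shiftΔ R (invertˡ d₁ e)) (shiftΔ R (invertˡ d₂ e)))
    invertˡ (∨R d) e     = unshiftΔ R (∨R (shiftΔ₂ R (invertˡ d e)))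
    invertˡ (→R d) e     = unshiftΔ R (→R (shiftΓ L (shiftΔ R (invertˡ d (↭-prep-swap e)))))
    invertˡ (¬R d) e     = unshiftΔ R (¬R (shiftΓ L (invertˡ d (↭-prep-swap e))))
    invertˡ (□Kn⁺ _ _ atoms _ _) e =
      ⊥-elim (F-compound (All.lookup atoms (∈-resp-↭ (↭-sym e) (here refl))))
    invertˡ (∧L d) e with ↭-∷-inv e
    ... | inj₁ (refl , Γ↭)    = permΓ (++⁺ˡ L Γ↭) (principal (∧L d))
    ... | inj₂ (_ , Γ↭ , Γ'↭) =
      reinsert Γ'↭ (∧L (shiftΓ₂ L (invertˡ d (↭-prep-swap (↭-prep-swap Γ↭)))))
    invertˡ (∨L d₁ d₂) e with ↭-∷-inv e
    ... | inj₁ (refl , Γ↭)    = permΓ (++⁺ˡ L Γ↭) (principal (∨L d₁ d₂))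
    ... | inj₂ (_ , Γ↭ , Γ'↭) =
      reinsert Γ'↭ (∨L (shiftΓ L (invertˡ d₁ (↭-prep-swap Γ↭)))
                       (shiftΓ L (invertˡ d₂ (↭-prep-swap Γ↭))))
    invertˡ (→L d₁ d₂) e with ↭-∷-inv e
    ... | inj₁ (refl , Γ↭)    = permΓ (++⁺ˡ L Γ↭) (principal (→L d₁ d₂))
    ... | inj₂ (_ , Γ↭ , Γ'↭) =
      reinsert Γ'↭ (→L (shiftΔ R (invertˡ d₁ Γ↭)) (shiftΓ L (invertˡ d₂ (↭-prep-swap Γ↭))))
    invertˡ (¬L d) e with ↭-∷-inv e
    ... | inj₁ (refl , Γ↭)    = permΓ (++⁺ˡ L Γ↭) (principal (¬L d))
    ... | inj₂ (_ , Γ↭ , Γ'↭) = reinsert Γ'↭ (¬L (shiftΔ R (invertˡ d Γ↭)))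
    invertˡ (□Tn⁺ i d) e with ↭-∷-inv e
    ... | inj₁ (refl , Γ↭)    = permΓ (++⁺ˡ L Γ↭) (principal (□Tn⁺ d))
    ... | inj₂ (_ , Γ↭ , Γ'↭) =
      reinsert Γ'↭ (□Tn⁺ i (perm (shift _ S _) (shift _ L _) ↭-refl (invertˡ d (↭-prep-swap Γ↭))))

  module _ (F : Fm n) (L R : List (Fm n)) (F-nonΩ : ¬ OmegaK F)
           (principal : ∀ {Σ Γ Δ} → RightPremises Σ F Γ Δ → G⁺ Σ (L ++ Γ) (R ++ Δ)) where

    private
      reinsert : Δ' ↭ A ∷ T → G⁺ Σ Γ (A ∷ R ++ T) → G⁺ Σ Γ (R ++ Δ')
      reinsert Δ'↭ = permΔ (↭-sym (++-pull R Δ'↭))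

    invertʳ : G⁺ Σ Γ Δ → Δ ↭ F ∷ Δ' → G⁺ Σ (L ++ Γ) (R ++ Δ')
    invertʳ (ax p boxed) e with ∈-resp-↭ e (here refl)
    ... | here refl  = ⊥-elim (F-nonΩ (inj₁ tt))
    ... | there p∈Δ' = ax∈ boxed (∈-++⁺ʳ L (here refl)) (∈-++⁺ʳ R p∈Δ')
    invertʳ (ax⊥ boxed) e    = ax⊥∈ boxed (∈-++⁺ʳ L (here refl))
    invertʳ (perm σ γ δ d) e = perm σ (++⁺ˡ L γ) ↭-refl (invertʳ d (↭-trans δ e))
    invertʳ (∧L d) e         = unshiftΓ L (∧L (shiftΓ₂ L (invertʳ d e)))
    invertʳ (∨L d₁ d₂) e     =
      unshiftΓ L (∨L (shiftΓ L (invertʳ d₁ e)) (shiftΓ L (invertʳ d₂ e)))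
    invertʳ (→L d₁ d₂) e     =
      unshiftΓ L (→L (shiftΔ R (invertʳ d₁ (↭-prep-swap e))) (shiftΓ L (invertʳ d₂ e)))
    invertʳ (¬L d) e         = unshiftΓ L (¬L (shiftΔ R (invertʳ d (↭-prep-swap e))))
    invertʳ (□Tn⁺ i d) e     = unshiftΓ L (□Tn⁺ i (shiftΓ L (invertʳ d e)))
    invertʳ (□Kn⁺ _ _ _ omega _) e with ∈-resp-↭ (↭-sym e) (here refl)
    ... | here refl = ⊥-elim (F-nonΩ (inj₂ tt))
    ... | there F∈Ω = ⊥-elim (F-nonΩ (All.lookup omega F∈Ω))
    invertʳ (∧R d₁ d₂) e with ↭-∷-inv e
    ... | inj₁ (refl , Δ↭)    = permΔ (++⁺ˡ R Δ↭) (principal (∧R d₁ d₂))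
    ... | inj₂ (_ , Δ↭ , Δ'↭) =
      reinsert Δ'↭ (∧R (shiftΔ R (invertʳ d₁ (↭-prep-swap Δ↭)))
                       (shiftΔ R (invertʳ d₂ (↭-prep-swap Δ↭))))
    invertʳ (∨R d) e with ↭-∷-inv e
    ... | inj₁ (refl , Δ↭)    = permΔ (++⁺ˡ R Δ↭) (principal (∨R d))
    ... | inj₂ (_ , Δ↭ , Δ'↭) =
      reinsert Δ'↭ (∨R (shiftΔ₂ R (invertʳ d (↭-prep-swap (↭-prep-swap Δ↭)))))
    invertʳ (→R d) e with ↭-∷-inv e
    ... | inj₁ (refl , Δ↭)    = permΔ (++⁺ˡ R Δ↭) (principal (→R d))
    ... | inj₂ (_ , Δ↭ , Δ'↭) =
      reinsert Δ'↭ (→R (shiftΓ L (shiftΔ R (invertʳ d (↭-prep-swap Δ↭)))))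
    invertʳ (¬R d) e with ↭-∷-inv e
    ... | inj₁ (refl , Δ↭)    = permΔ (++⁺ˡ R Δ↭) (principal (¬R d))
    ... | inj₂ (_ , Δ↭ , Δ'↭) = reinsert Δ'↭ (¬R (shiftΓ L (invertʳ d Δ↭)))

  ∧L⁻¹ : G⁺ Σ ((A ∧' B) ∷ Γ) Δ → G⁺ Σ (A ∷ B ∷ Γ) Δ
  ∧L⁻¹ {A = A} {B} d =
    invertˡ (A ∧' B) (A ∷ B ∷ []) [] [] (λ ()) (λ { (∧L d) → d }) d ↭-refl

  ∨L⁻¹ˡ : G⁺ Σ ((A ∨' B) ∷ Γ) Δ → G⁺ Σ (A ∷ Γ) Δ
  ∨L⁻¹ˡ {A = A} {B} d =
    invertˡ (A ∨' B) (A ∷ []) [] [] (λ ()) (λ { (∨L d _) → d }) d ↭-refl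

  ∨L⁻¹ʳ : G⁺ Σ ((A ∨' B) ∷ Γ) Δ → G⁺ Σ (B ∷ Γ) Δ
  ∨L⁻¹ʳ {A = A} {B} d =
    invertˡ (A ∨' B) (B ∷ []) [] [] (λ ()) (λ { (∨L _ d) → d }) d ↭-refl

  →L⁻¹ˡ : G⁺ Σ ((A ⇒' B) ∷ Γ) Δ → G⁺ Σ Γ (A ∷ Δ)
  →L⁻¹ˡ {A = A} {B} d =
    invertˡ (A ⇒' B) [] (A ∷ []) [] (λ ()) (λ { (→L d _) → d }) d ↭-refl

  →L⁻¹ʳ : G⁺ Σ ((A ⇒' B) ∷ Γ) Δ → G⁺ Σ (B ∷ Γ) Δ
  →L⁻¹ʳ {A = A} {B} d =
    invertˡ (A ⇒' B) (B ∷ []) [] [] (λ ()) (λ { (→L _ d) → d }) d ↭-refl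

  ¬L⁻¹ : G⁺ Σ ((¬' A) ∷ Γ) Δ → G⁺ Σ Γ (A ∷ Δ)
  ¬L⁻¹ {A = A} d =
    invertˡ (¬' A) [] (A ∷ []) [] (λ ()) (λ { (¬L d) → d }) d ↭-refl

  □Tn⁺⁻¹ : G⁺ Σ (□ i A ∷ Γ) Δ → G⁺ (□ i A ∷ Σ) (A ∷ Γ) Δ
  □Tn⁺⁻¹ {i = i} {A = A} d =
    invertˡ (□ i A) (A ∷ []) [] (tt ∷ []) (λ ()) (λ { (□Tn⁺ d) → d }) d ↭-refl

  ∧R⁻¹ˡ : G⁺ Σ Γ ((A ∧' B) ∷ Δ) → G⁺ Σ Γ (A ∷ Δ)
  ∧R⁻¹ˡ {A = A} {B} d =
    invertʳ (A ∧' B) [] (A ∷ []) (λ { (inj₁ ()) ; (inj₂ ()) }) (λ { (∧R d _) → d }) d ↭-refl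

  ∧R⁻¹ʳ : G⁺ Σ Γ ((A ∧' B) ∷ Δ) → G⁺ Σ Γ (B ∷ Δ)
  ∧R⁻¹ʳ {A = A} {B} d =
    invertʳ (A ∧' B) [] (B ∷ []) (λ { (inj₁ ()) ; (inj₂ ()) }) (λ { (∧R _ d) → d }) d ↭-refl

  ∨R⁻¹ : G⁺ Σ Γ ((A ∨' B) ∷ Δ) → G⁺ Σ Γ (A ∷ B ∷ Δ)
  ∨R⁻¹ {A = A} {B} d =
    invertʳ (A ∨' B) [] (A ∷ B ∷ []) (λ { (inj₁ ()) ; (inj₂ ()) }) (λ { (∨R d) → d }) d ↭-refl

  →R⁻¹ : G⁺ Σ Γ ((A ⇒' B) ∷ Δ) → G⁺ Σ (A ∷ Γ) (B ∷ Δ)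
  →R⁻¹ {A = A} {B} d =
    invertʳ (A ⇒' B) (A ∷ []) (B ∷ []) (λ { (inj₁ ()) ; (inj₂ ()) }) (λ { (→R d) → d }) d ↭-refl

  ¬R⁻¹ : G⁺ Σ Γ ((¬' A) ∷ Δ) → G⁺ Σ (A ∷ Γ) Δ
  ¬R⁻¹ {A = A} d =
    invertʳ (¬' A) (A ∷ []) [] (λ { (inj₁ ()) ; (inj₂ ()) }) (λ { (¬R d) → d }) d ↭-refl

  contract-varˡ : G⁺ Σ Γ Δ → Γ ↭ var p ∷ var p ∷ Γ' → G⁺ Σ (var p ∷ Γ') Δ
  contract-varˡ (ax _ boxed) e   = ax∈ boxed (∈-∷-contract (∈-resp-↭ e (here refl))) (here refl)
  contract-varˡ (ax⊥ boxed) e    = ax⊥∈ boxed (∈-∷-contract (∈-resp-↭ e (here refl)))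
  contract-varˡ (perm σ γ δ d) e = perm σ ↭-refl δ (contract-varˡ d (↭-trans γ e))
  contract-varˡ (∧R d₁ d₂) e     = ∧R (contract-varˡ d₁ e) (contract-varˡ d₂ e)
  contract-varˡ (∨R d) e         = ∨R (contract-varˡ d e)
  contract-varˡ (→R d) e         = →R (exchangeΓ (contract-varˡ d (↭-prep-swap₂ e)))
  contract-varˡ (¬R d) e         = ¬R (exchangeΓ (contract-varˡ d (↭-prep-swap₂ e)))
  contract-varˡ (□Kn⁺ i others atoms omega d) e =
    □Kn⁺ i others (All.tail (All-resp-↭ e atoms)) omega d
  contract-varˡ (∧L d) e with _ , Γ'↭ , Γ↭ ← ↭-∷∷-inv (λ ()) e =
    permΓ (↭-sym (↭-prep-swap Γ'↭))
          (∧L (shiftΓ₂ (_ ∷ []) (contract-varˡ d (↭-prep-swap₂ (↭-prep-swap₂ Γ↭)))))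
  contract-varˡ (∨L d₁ d₂) e with _ , Γ'↭ , Γ↭ ← ↭-∷∷-inv (λ ()) e =
    permΓ (↭-sym (↭-prep-swap Γ'↭))
          (∨L (exchangeΓ (contract-varˡ d₁ (↭-prep-swap₂ Γ↭)))
              (exchangeΓ (contract-varˡ d₂ (↭-prep-swap₂ Γ↭))))
  contract-varˡ (→L d₁ d₂) e with _ , Γ'↭ , Γ↭ ← ↭-∷∷-inv (λ ()) e =
    permΓ (↭-sym (↭-prep-swap Γ'↭))
          (→L (contract-varˡ d₁ Γ↭) (exchangeΓ (contract-varˡ d₂ (↭-prep-swap₂ Γ↭))))
  contract-varˡ (¬L d) e with _ , Γ'↭ , Γ↭ ← ↭-∷∷-inv (λ ()) e =
    permΓ (↭-sym (↭-prep-swap Γ'↭)) (¬L (contract-varˡ d Γ↭))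
  contract-varˡ (□Tn⁺ i d) e with _ , Γ'↭ , Γ↭ ← ↭-∷∷-inv (λ ()) e =
    permΓ (↭-sym (↭-prep-swap Γ'↭)) (□Tn⁺ i (exchangeΓ (contract-varˡ d (↭-prep-swap₂ Γ↭))))

  Ω-≢ : OmegaK F → ¬ OmegaK A → A ≢ F
  Ω-≢ Ω-F ¬Ω-A refl = ¬Ω-A Ω-F

  contract-Ωʳ : OmegaK F → G⁺ Σ Γ Δ → Δ ↭ F ∷ F ∷ Δ' → G⁺ Σ Γ (F ∷ Δ')
  contract-Ωʳ Ω-F (ax _ boxed) e   = ax∈ boxed (here refl) (∈-∷-contract (∈-resp-↭ e (here refl)))
  contract-Ωʳ Ω-F (ax⊥ boxed) e    = ax⊥ boxed
  contract-Ωʳ Ω-F (perm σ γ δ d) e = perm σ γ ↭-refl (contract-Ωʳ Ω-F d (↭-trans δ e))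
  contract-Ωʳ Ω-F (∧L d) e         = ∧L (contract-Ωʳ Ω-F d e)
  contract-Ωʳ Ω-F (∨L d₁ d₂) e     = ∨L (contract-Ωʳ Ω-F d₁ e) (contract-Ωʳ Ω-F d₂ e)
  contract-Ωʳ Ω-F (→L d₁ d₂) e     =
    →L (exchangeΔ (contract-Ωʳ Ω-F d₁ (↭-prep-swap₂ e))) (contract-Ωʳ Ω-F d₂ e)
  contract-Ωʳ Ω-F (¬L d) e         = ¬L (exchangeΔ (contract-Ωʳ Ω-F d (↭-prep-swap₂ e)))
  contract-Ωʳ Ω-F (□Tn⁺ i d) e     = □Tn⁺ i (contract-Ωʳ Ω-F d e)
  contract-Ωʳ Ω-F (□Kn⁺ i others atoms omega d) e =
    let _ , F∷Δ'↭ = ∈-∃↭∷ (∈-∷-contract (∈-resp-↭ e (here refl)))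
        omega'    = All.tail (All-resp-↭ F∷Δ'↭ (All.tail (All-resp-↭ e (inj₂ tt ∷ omega))))
    in  permΔ (↭-sym F∷Δ'↭) (□Kn⁺ i others atoms omega' d)
  contract-Ωʳ Ω-F (∧R d₁ d₂) e
    with _ , Δ'↭ , Δ↭ ← ↭-∷∷-inv (Ω-≢ Ω-F λ { (inj₁ ()) ; (inj₂ ()) }) e =
    permΔ (↭-sym (↭-prep-swap Δ'↭))
          (∧R (exchangeΔ (contract-Ωʳ Ω-F d₁ (↭-prep-swap₂ Δ↭)))
              (exchangeΔ (contract-Ωʳ Ω-F d₂ (↭-prep-swap₂ Δ↭))))
  contract-Ωʳ Ω-F (∨R d) e
    with _ , Δ'↭ , Δ↭ ← ↭-∷∷-inv (Ω-≢ Ω-F λ { (inj₁ ()) ; (inj₂ ()) }) e =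
    permΔ (↭-sym (↭-prep-swap Δ'↭))
          (∨R (shiftΔ₂ (_ ∷ []) (contract-Ωʳ Ω-F d (↭-prep-swap₂ (↭-prep-swap₂ Δ↭)))))
  contract-Ωʳ Ω-F (→R d) e
    with _ , Δ'↭ , Δ↭ ← ↭-∷∷-inv (Ω-≢ Ω-F λ { (inj₁ ()) ; (inj₂ ()) }) e =
    permΔ (↭-sym (↭-prep-swap Δ'↭)) (→R (exchangeΔ (contract-Ωʳ Ω-F d (↭-prep-swap₂ Δ↭))))
  contract-Ωʳ Ω-F (¬R d) e
    with _ , Δ'↭ , Δ↭ ← ↭-∷∷-inv (Ω-≢ Ω-F λ { (inj₁ ()) ; (inj₂ ()) }) e =
    permΔ (↭-sym (↭-prep-swap Δ'↭)) (¬R (contract-Ωʳ Ω-F d Δ↭))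

  □-store-own : All (IsBoxedNot i) Σ₀ → Σ₀ ++ map (□ i) Γ₀ ↭ □ i A ∷ T →
                ∃ λ Γ₁ → Γ₀ ↭ A ∷ Γ₁ × Σ₀ ++ map (□ i) Γ₁ ↭ T
  □-store-own {Σ₀ = Σ₀} others e with ∈-++⁻ Σ₀ (∈-resp-↭ (↭-sym e) (here refl))
  ... | inj₁ □A∈Σ₀  = ⊥-elim (All.lookup others □A∈Σ₀ refl)
  ... | inj₂ □A∈□Γ₀ with _ , A∈Γ₀ , refl ← ∈-map⁻ (□ _) □A∈□Γ₀ =
    let Γ₁ , Γ₀↭ = ∈-∃↭∷ A∈Γ₀
    in  Γ₁ , Γ₀↭ , drop-∷ (↭-trans (↭-sym (++-pull Σ₀ (map⁺ (□ _) Γ₀↭))) e)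

  □-store-other : i ≢ j → Σ₀ ++ map (□ j) Γ₀ ↭ □ i A ∷ T →
                  ∃ λ Σ₁ → Σ₀ ↭ □ i A ∷ Σ₁ × Σ₁ ++ map (□ j) Γ₀ ↭ T
  □-store-other {Σ₀ = Σ₀} i≢j e with ∈-++⁻ Σ₀ (∈-resp-↭ (↭-sym e) (here refl))
  ... | inj₂ □A∈□Γ₀ with _ , _ , refl ← ∈-map⁻ (□ _) □A∈□Γ₀ = ⊥-elim (i≢j refl)
  ... | inj₁ □A∈Σ₀ =
    let Σ₁ , Σ₀↭ = ∈-∃↭∷ □A∈Σ₀
    in  Σ₁ , Σ₀↭ , drop-∷ (↭-trans (↭-sym (++⁺ʳ _ Σ₀↭)) e)

  -- Terminates since contractΣ, called by contractˡ on □ i A, calls contractˡ only on A.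
  contractˡ : (A : Fm n) → G⁺ Σ (A ∷ A ∷ Γ) Δ → G⁺ Σ (A ∷ Γ) Δ
  contractʳ : (A : Fm n) → G⁺ Σ Γ (A ∷ A ∷ Δ) → G⁺ Σ Γ (A ∷ Δ)
  contractΣ : G⁺ Σ Γ Δ → Σ ↭ □ i A ∷ □ i A ∷ Σ' → G⁺ (□ i A ∷ Σ') Γ Δ

  contractˡ (var p) d  = contract-varˡ d ↭-refl
  contractˡ fls d      = ax⊥ (Σ-boxed d)
  contractˡ (A ∧' B) d = ∧L (exchangeΓ (contractˡ B (shiftΓ₂ (A ∷ []) (contractˡ A AABB))))
    where
    AABB : G⁺ _ (A ∷ A ∷ B ∷ B ∷ _) _
    AABB = permΓ (↭-prep A (↭-swap B A ↭-refl)) (∧L⁻¹ (shiftΓ (A ∷ B ∷ []) (∧L⁻¹ d)))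
  contractˡ (A ∨' B) d =
    ∨L (contractˡ A (∨L⁻¹ˡ (exchangeΓ (∨L⁻¹ˡ d))))
       (contractˡ B (∨L⁻¹ʳ (exchangeΓ (∨L⁻¹ʳ d))))
  contractˡ (A ⇒' B) d =
    →L (contractʳ A (→L⁻¹ˡ (→L⁻¹ˡ d))) (contractˡ B (→L⁻¹ʳ (exchangeΓ (→L⁻¹ʳ d))))
  contractˡ (¬' A) d   = ¬L (contractʳ A (¬L⁻¹ (¬L⁻¹ d)))
  contractˡ (□ i A) d  =
    □Tn⁺ i (contractΣ (contractˡ A (□Tn⁺⁻¹ (exchangeΓ (□Tn⁺⁻¹ d)))) ↭-refl)

  contractʳ (var p) d  = contract-Ωʳ (inj₁ tt) d ↭-refl
  contractʳ fls d      = contract-Ωʳ (inj₁ tt) d ↭-refl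
  contractʳ (□ i A) d  = contract-Ωʳ (inj₂ tt) d ↭-refl
  contractʳ (A ∧' B) d =
    ∧R (contractʳ A (∧R⁻¹ˡ (exchangeΔ (∧R⁻¹ˡ d))))
       (contractʳ B (∧R⁻¹ʳ (exchangeΔ (∧R⁻¹ʳ d))))
  contractʳ (A ∨' B) d = ∨R (exchangeΔ (contractʳ B (shiftΔ₂ (A ∷ []) (contractʳ A AABB))))
    where
    AABB : G⁺ _ _ (A ∷ A ∷ B ∷ B ∷ _)
    AABB = permΔ (↭-prep A (↭-swap B A ↭-refl)) (∨R⁻¹ (shiftΔ (A ∷ B ∷ []) (∨R⁻¹ d)))
  contractʳ (A ⇒' B) d = →R (contractˡ A (contractʳ B (→R⁻¹ (exchangeΔ (→R⁻¹ d)))))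
  contractʳ (¬' A) d   = ¬R (contractˡ A (¬R⁻¹ (¬R⁻¹ d)))

  contractΣ (ax p boxed) e   = ax p (All.tail (All-resp-↭ e boxed))
  contractΣ (ax⊥ boxed) e    = ax⊥ (All.tail (All-resp-↭ e boxed))
  contractΣ (perm σ γ δ d) e = perm ↭-refl γ δ (contractΣ d (↭-trans σ e))
  contractΣ (∧L d) e         = ∧L (contractΣ d e)
  contractΣ (∧R d₁ d₂) e     = ∧R (contractΣ d₁ e) (contractΣ d₂ e)
  contractΣ (∨L d₁ d₂) e     = ∨L (contractΣ d₁ e) (contractΣ d₂ e)
  contractΣ (∨R d) e         = ∨R (contractΣ d e)
  contractΣ (→L d₁ d₂) e     = →L (contractΣ d₁ e) (contractΣ d₂ e)
  contractΣ (→R d) e         = →R (contractΣ d e)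
  contractΣ (¬L d) e         = ¬L (contractΣ d e)
  contractΣ (¬R d) e         = ¬R (contractΣ d e)
  contractΣ (□Tn⁺ j d) e     = □Tn⁺ j (exchangeΣ (contractΣ d (↭-prep-swap₂ e)))
  contractΣ {i = i} (□Kn⁺ j others atoms omega d) e with i ≟ᶠ j
  contractΣ {A = A} (□Kn⁺ {Σ = Σ₀} i others atoms omega d) e | yes refl =
    let Γ₁ , Γ₀↭ , e₁ = □-store-own others e
        Γ₂ , Γ₁↭ , e₂ = □-store-own others e₁
    in  permΣ (↭-trans (shift _ Σ₀ _) (↭-prep _ e₂))
              (□Kn⁺ i others atoms omega (contractˡ A (permΓ (↭-trans Γ₀↭ (↭-prep A Γ₁↭)) d)))
  contractΣ (□Kn⁺ j others atoms omega d) e | no i≢j =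
    let Σ₁ , Σ₀↭ , e₁ = □-store-other i≢j e
        Σ₂ , Σ₁↭ , e₂ = □-store-other i≢j e₁
        others'       = All.tail (All-resp-↭ (↭-trans Σ₀↭ (↭-prep _ Σ₁↭)) others)
    in  permΣ (↭-prep _ e₂) (□Kn⁺ j others' atoms omega d)

  release₁ : G⁺ (□ i C ∷ Σ) Γ Δ → G⁺ Σ (□ i C ∷ Γ) Δ
  release₁ {i = i} {C = C} d = □Tn⁺ i (weakenˡ (C ∷ []) d)

  release : ∀ Γ₀ → G⁺ (map (□ i) Γ₀ ++ Σ) Γ Δ → G⁺ Σ (map (□ i) Γ₀ ++ Γ) Δ
  release []       d = d
  release (C ∷ Γ₀) d = shiftΓ (map (□ _) Γ₀) (release Γ₀ (release₁ d))

  permG : Γ ↭ Γ' → G Γ Δ → G Γ' Δ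
  permG γ = perm γ ↭-refl

  shiftG : ∀ L → G (L ++ A ∷ Γ) Δ → G (A ∷ L ++ Γ) Δ
  shiftG L = permG (shift _ L _)

  unshiftG : ∀ L → G (A ∷ L ++ Γ) Δ → G (L ++ A ∷ Γ) Δ
  unshiftG L = permG (↭-sym (shift _ L _))

  G⁺⇒G : G⁺ Σ Γ Δ → G (Σ ++ Γ) Δ
  G⁺⇒G {Σ = Σ} (ax p _)   = unshiftG Σ (ax p)
  G⁺⇒G {Σ = Σ} (ax⊥ _)    = unshiftG Σ ax⊥
  G⁺⇒G (perm σ γ δ d)     = perm (↭-trans (++⁺ʳ _ σ) (++⁺ˡ _ γ)) δ (G⁺⇒G d)
  G⁺⇒G {Σ = Σ} (∧L d)     = unshiftG Σ (∧L (permG (shifts Σ (_ ∷ _ ∷ [])) (G⁺⇒G d)))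
  G⁺⇒G (∧R d₁ d₂)         = ∧R (G⁺⇒G d₁) (G⁺⇒G d₂)
  G⁺⇒G {Σ = Σ} (∨L d₁ d₂) = unshiftG Σ (∨L (shiftG Σ (G⁺⇒G d₁)) (shiftG Σ (G⁺⇒G d₂)))
  G⁺⇒G (∨R d)             = ∨R (G⁺⇒G d)
  G⁺⇒G {Σ = Σ} (→L d₁ d₂) = unshiftG Σ (→L (G⁺⇒G d₁) (shiftG Σ (G⁺⇒G d₂)))
  G⁺⇒G {Σ = Σ} (→R d)     = →R (shiftG Σ (G⁺⇒G d))
  G⁺⇒G {Σ = Σ} (¬L d)     = unshiftG Σ (¬L (G⁺⇒G d))
  G⁺⇒G {Σ = Σ} (¬R d)     = ¬R (shiftG Σ (G⁺⇒G d))
  G⁺⇒G {Σ = Σ} (□Tn⁺ i d) = unshiftG Σ (□Tn i (permG (↭-prep _ (shift _ Σ _)) (G⁺⇒G d)))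
  G⁺⇒G (□Kn⁺ {Σ = Σ₀} {Π = Π} i others atoms omega d) =
    permG (solve 3 (λ xs ys zs → (xs ⊕ ys) ⊕ zs ⊜ (xs ⊕ zs) ⊕ ys) ↭-refl Σ₀ Π _)
          (□Kn i (Allₚ.++⁺ (All.map inj₂ others) (All.map inj₁ atoms)) omega (G⁺⇒G d))

  G⇒G⁺ : G Γ Δ → G⁺ [] Γ Δ
  G⇒G⁺ (ax p)            = ax p []
  G⇒G⁺ ax⊥               = ax⊥ []
  G⇒G⁺ (perm γ δ d)      = perm ↭-refl γ δ (G⇒G⁺ d)
  G⇒G⁺ (∧L d)            = ∧L (G⇒G⁺ d)
  G⇒G⁺ (∧R d₁ d₂)        = ∧R (G⇒G⁺ d₁) (G⇒G⁺ d₂)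
  G⇒G⁺ (∨L d₁ d₂)        = ∨L (G⇒G⁺ d₁) (G⇒G⁺ d₂)
  G⇒G⁺ (∨R d)            = ∨R (G⇒G⁺ d)
  G⇒G⁺ (→L d₁ d₂)        = →L (G⇒G⁺ d₁) (G⇒G⁺ d₂)
  G⇒G⁺ (→R d)            = →R (G⇒G⁺ d)
  G⇒G⁺ (¬L d)            = ¬L (G⇒G⁺ d)
  G⇒G⁺ (¬R d)            = ¬R (G⇒G⁺ d)
  G⇒G⁺ (□Tn {A = A} i d) = □Tn⁺ i (contractˡ A (□Tn⁺⁻¹ (G⇒G⁺ d)))
  G⇒G⁺ (□Kn {Γ = Γ₀} {Σ = Σ₀} i _ omega d) =
    permΓ (solve 2 (λ xs ys → ys ⊕ (xs ⊕ id) ⊜ xs ⊕ ys) ↭-refl Σ₀ (map (□ i) Γ₀))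
          (release Γ₀ (permΣ (↭-sym (++-identityʳ _))
                             (weakenˡ Σ₀ (□Kn⁺ {Σ = []} {Π = []} i [] [] omega (G⇒G⁺ d)))))

lemma4p13 : (n : ℕ) (Γ Δ : List (Fm n)) →
    (G Γ Δ → G⁺ [] Γ Δ) × (G⁺ [] Γ Δ → G Γ Δ)
lemma4p13 n Γ Δ = G⇒G⁺ , G⁺⇒G
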